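{- Every graph in $\mathcal{B}$ is adjacent in $\mathcal{G}_6^*$ to a graph in $\mathcal{A}$.
   Context: $\mathcal{G}_6$ is the set of simple 3-regular graphs on vertex set $\{1,\dots,6\}$. A make move ${\tt make}(yxvwz)$ applies to $G=(V,E)$ when $y,x,v,w,z$ are distinct, $yx,xv,vw,wz\in E$ and $xw,yz\notin E$, and replaces $E$ by $(E\setminus\{xy,wz\})\cup\{xw,yz\}$. A break move ${\tt break}(vxw,yz)$ applies when $vxwv$ is a triangle, $yz\in E$, $\{y,z\}\cap\{v,x,w\}=\emptyset$ and $xy,wz\notin E$, and replaces $E$ by $(E\setminus\{xw,yz\})\cup\{xy,wz\}$. $\mathcal{G}_6^*$ is the graph on vertex set $\mathcal{G}_6$ with $G,G'$ adjacent iff a make or break move takes $G$ to $G'$. $\mathcal{A}$ is the set of graphs in $\mathcal{G}_6$ isomorphic to $K_{3,3}$, and $\mathcal{B}$ is the set of graphs in $\mathcal{G}_6$ isomorphic to the triangular prism (the complement of the 6-cycle). -}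

module Defs where

open import Data.Nat using (ℕ; _<ᵇ_; _≡ᵇ_; _+_; _%_)
open import Data.Nat.ListAction using (sum)
open import Data.Bool using (Bool; true; false; _∧_; _∨_; not; if_then_else_)
open import Data.Fin using (Fin; toℕ)
open import Data.Fin.Properties using (_≟_)
open import Data.List using (List; map)
open import Data.List using () renaming (allFin to allFinL)
open import Data.Fin.Permutation using (Permutation′; _⟨$⟩ʳ_)
open import Data.Product using (Σ; _×_; ∃; _,_)
open import Data.Sum using (_⊎_)
open import Relation.Binary.PropositionalEquality using (_≡_; _≢_)
open import Relation.Nullary.Decidable using (⌊_⌋)

V : Set
V = Fin 6

_==_ : V → V → Bool
a == b = ⌊ a ≟ b ⌋

bit : Bool → ℕ
bit true  = 1
bit false = 0

-- simple 3-regular graph on vertex set {1,…,6} (encoded as Fin 6),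
-- given by its adjacency relation (edge set E)
record Graph6 : Set where
  field
    adj    : V → V → Bool
    sym    : ∀ a b → adj a b ≡ adj b a
    irrefl : ∀ a → adj a a ≡ false
    deg3   : ∀ a → sum (map (λ b → bit (adj a b)) (allFinL 6)) ≡ 3
open Graph6 public

samePair : V → V → V → V → Bool
samePair x y a b = ((a == x) ∧ (b == y)) ∨ ((a == y) ∧ (b == x))

swapEdges : (V → V → Bool) → V → V → V → V → V → V → V → V → V → V → Bool
swapEdges E r₁ s₁ r₂ s₂ p₁ q₁ p₂ q₂ a b =
  (E a b ∧ not (samePair r₁ s₁ a b) ∧ not (samePair r₂ s₂ a b))
  ∨ samePair p₁ q₁ a b ∨ samePair p₂ q₂ a b

Make : Graph6 → Graph6 → Set
Make G G' = Σ V λ y → Σ V λ x → Σ V λ v → Σ V λ w → Σ V λ z →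
  (y ≢ x) × (y ≢ v) × (y ≢ w) × (y ≢ z) × (x ≢ v) × (x ≢ w) × (x ≢ z)
  × (v ≢ w) × (v ≢ z) × (w ≢ z)
  × adj G y x ≡ true × adj G x v ≡ true × adj G v w ≡ true × adj G w z ≡ true
  × adj G x w ≡ false × adj G y z ≡ false
  × (∀ a b → adj G' a b ≡ swapEdges (adj G) x y w z x w y z a b)

Break : Graph6 → Graph6 → Set
Break G G' = Σ V λ v → Σ V λ x → Σ V λ w → Σ V λ y → Σ V λ z →
  adj G v x ≡ true × adj G x w ≡ true × adj G w v ≡ true
  × adj G y z ≡ true
  × (y ≢ v) × (y ≢ x) × (y ≢ w) × (z ≢ v) × (z ≢ x) × (z ≢ w)
  × adj G x y ≡ false × adj G w z ≡ false
  × (∀ a b → adj G' a b ≡ swapEdges (adj G) x w y z x y w z a b)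

Move : Graph6 → Graph6 → Set
Move G G' = Make G G' ⊎ Break G G'

Adjacent : Graph6 → Graph6 → Set
Adjacent G G' = Move G G' ⊎ Move G' G

IsoTo : Graph6 → (V → V → Bool) → Set
IsoTo G H = Σ (Permutation′ 6) λ σ →
  ∀ a b → adj G (σ ⟨$⟩ʳ a) (σ ⟨$⟩ʳ b) ≡ H a b

part : V → Bool
part a = toℕ a <ᵇ 3

K33 : V → V → Bool
K33 a b = (part a ∧ not (part b)) ∨ (part b ∧ not (part a))

C6 : V → V → Bool
C6 a b = (toℕ a ≡ᵇ ((toℕ b + 1) % 6)) ∨ (toℕ b ≡ᵇ ((toℕ a + 1) % 6))

-- triangular prism = complement of the 6-cycle
Prism : V → V → Bool
Prism a b = not (a == b) ∧ not (C6 a b)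

InA : Graph6 → Set
InA G = IsoTo G K33

InB : Graph6 → Set
InB G = IsoTo G Prism

module Submission where

-- The triangular prism has the two triangles 1-3-5 and 0-2-4;
-- breaking the triangle 1-3-5 at the edge 2-0, i.e. the move
-- break(1 3 5, 2 0) which trades the edges 3-5, 2-0 for 3-2, 5-0, turns it
-- into K₃,₃ with parts {0,1,2} and {3,4,5}.  An arbitrary graph of ℬ is a
-- relabelling of the prism, and moves are compatible with relabelling, so
-- the same move (on the relabelled vertices) takes it to a relabelling of
-- K₃,₃, which lies in 𝒜.

open import Defs
open import Data.Bool using (Bool; false)
import Data.Bool.Properties as Bool
open import Data.Nat using (ℕ)
import Data.Nat.Properties as ℕ
open import Data.Nat.ListAction using (sum)
open import Data.List using (map) renaming (allFin to allFinL)
open import Data.Fin.Patterns using (0F; 1F; 2F; 3F; 5F)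
open import Data.Fin.Properties using (_≟_; all?)
open import Data.Fin.Permutation using (Permutation′; _⟨$⟩ʳ_; _⟨$⟩ˡ_; inverseˡ; inverseʳ)
open import Data.Product using (Σ; _×_; _,_)
open import Data.Sum using (inj₁; inj₂)
open import Function.Bundles using (mk⇔)
open import Relation.Nullary.Decidable using (Dec; True; toWitness; isYes≗does; does-⇔)
open import Relation.Binary.PropositionalEquality
  using (_≡_; _≢_; refl; trans; cong; cong₂; module ≡-Reasoning)
  renaming (sym to ≡-sym)
open import Algebra.Properties.CommutativeMonoid.Sum ℕ.+-0-commutativeMonoid
  using (sum-permute; sum-cong-≗) renaming (sum to ∑)

Adjacency : Set
Adjacency = V → V → Bool

degree : Adjacency → V → ℕ
degree E a = sum (map (λ b → bit (E a b)) (allFinL 6))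

byEvaluation : {P : V → Set} (P? : ∀ a → Dec (P a))
             → {True (all? P?)} → ∀ a → P a
byEvaluation P? {ok} = toWitness ok

byEvaluation₂ : {P : V → V → Set} (P? : ∀ a b → Dec (P a b))
              → {True (all? λ a → all? (P? a))} → ∀ a b → P a b
byEvaluation₂ P? {ok} = toWitness ok

module Relabelling (σ : Permutation′ 6) where

  σ⁺ σ⁻ : V → V
  σ⁺ = σ ⟨$⟩ʳ_
  σ⁻ = σ ⟨$⟩ˡ_

  σ⁺-injective : ∀ {a b} → σ⁺ a ≡ σ⁺ b → a ≡ b
  σ⁺-injective {a} {b} e = trans (≡-sym (inverseˡ σ)) (trans (cong σ⁻ e) (inverseˡ σ))

  σ⁺-≢ : ∀ {a b} → a ≢ b → σ⁺ a ≢ σ⁺ b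
  σ⁺-≢ a≢b e = a≢b (σ⁺-injective e)

  ==-relabel : ∀ a b → (σ⁺ a == σ⁺ b) ≡ (a == b)
  ==-relabel a b = trans (isYes≗does (σ⁺ a ≟ σ⁺ b))
    (trans (does-⇔ (mk⇔ σ⁺-injective (cong σ⁺)) (σ⁺ a ≟ σ⁺ b) (a ≟ b))
           (≡-sym (isYes≗does (a ≟ b))))

  samePair-relabel : ∀ x y a b → samePair (σ⁺ x) (σ⁺ y) (σ⁺ a) (σ⁺ b) ≡ samePair x y a b
  samePair-relabel x y a b
    rewrite ==-relabel a x | ==-relabel b y | ==-relabel a y | ==-relabel b x = refl

  degree-relabel : (E : Adjacency) (a : V)
                 → degree (λ c d → E (σ⁻ c) (σ⁻ d)) a ≡ degree E (σ⁻ a)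
  degree-relabel E a = begin
    ∑ (λ b → bit (E (σ⁻ a) (σ⁻ b)))          ≡⟨ sum-permute (λ b → bit (E (σ⁻ a) (σ⁻ b))) σ ⟩
    ∑ (λ b → bit (E (σ⁻ a) (σ⁻ (σ⁺ b))))     ≡⟨ sum-cong-≗ (λ b → cong (λ c → bit (E (σ⁻ a) c)) (inverseˡ σ {b})) ⟩
    ∑ (λ b → bit (E (σ⁻ a) b))                ∎
    where open ≡-Reasoning

  relabel : Graph6 → Graph6
  relabel G = record
    { adj    = λ a b → adj G (σ⁻ a) (σ⁻ b)
    ; sym    = λ a b → sym G (σ⁻ a) (σ⁻ b)
    ; irrefl = λ a → irrefl G (σ⁻ a)
    ; deg3   = λ a → trans (degree-relabel (adj G) a) (deg3 G (σ⁻ a))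
    }

  relabel-iso : (G : Graph6) → IsoTo (relabel G) (adj G)
  relabel-iso G = σ , λ a b → cong₂ (adj G) (inverseˡ σ) (inverseˡ σ)

  swapEdges-relabel : (E : Adjacency) (r₁ s₁ r₂ s₂ p₁ q₁ p₂ q₂ a b : V)
    → swapEdges E (σ⁺ r₁) (σ⁺ s₁) (σ⁺ r₂) (σ⁺ s₂) (σ⁺ p₁) (σ⁺ q₁) (σ⁺ p₂) (σ⁺ q₂) (σ⁺ a) (σ⁺ b)
      ≡ swapEdges (λ c d → E (σ⁺ c) (σ⁺ d)) r₁ s₁ r₂ s₂ p₁ q₁ p₂ q₂ a b
  swapEdges-relabel E r₁ s₁ r₂ s₂ p₁ q₁ p₂ q₂ a b
    rewrite samePair-relabel r₁ s₁ a b | samePair-relabel r₂ s₂ a b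
          | samePair-relabel p₁ q₁ a b | samePair-relabel p₂ q₂ a b = refl

  break-relabel : (G H H' : Graph6)
    → (∀ a b → adj G (σ⁺ a) (σ⁺ b) ≡ adj H a b)
    → Break H H' → Break G (relabel H')
  break-relabel G H H' iso
    (v , x , w , y , z , vx , xw , wv , yz , y≢v , y≢x , y≢w , z≢v , z≢x , z≢w , xy , wz , H→H')
    = σ⁺ v , σ⁺ x , σ⁺ w , σ⁺ y , σ⁺ z
    , trans (iso v x) vx , trans (iso x w) xw , trans (iso w v) wv , trans (iso y z) yz
    , σ⁺-≢ y≢v , σ⁺-≢ y≢x , σ⁺-≢ y≢w , σ⁺-≢ z≢v , σ⁺-≢ z≢x , σ⁺-≢ z≢w
    , trans (iso x y) xy , trans (iso w z) wz
    , mirrored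
    where
    swapG swapH : Adjacency
    swapG = swapEdges (adj G) (σ⁺ x) (σ⁺ w) (σ⁺ y) (σ⁺ z) (σ⁺ x) (σ⁺ y) (σ⁺ w) (σ⁺ z)
    swapH = swapEdges (adj H) x w y z x y w z

    swap-pullback : ∀ a b → swapG (σ⁺ a) (σ⁺ b) ≡ swapH a b
    swap-pullback a b rewrite swapEdges-relabel (adj G) x w y z x y w z a b | iso a b = refl

    mirrored : ∀ a b → adj H' (σ⁻ a) (σ⁻ b) ≡ swapG a b
    mirrored a b = begin
      adj H' (σ⁻ a) (σ⁻ b)              ≡⟨ H→H' (σ⁻ a) (σ⁻ b) ⟩
      swapH (σ⁻ a) (σ⁻ b)               ≡⟨ swap-pullback (σ⁻ a) (σ⁻ b) ⟨
      swapG (σ⁺ (σ⁻ a)) (σ⁺ (σ⁻ b))     ≡⟨ cong₂ swapG (inverseʳ σ) (inverseʳ σ) ⟩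
      swapG a b                         ∎
      where open ≡-Reasoning

cubicByEvaluation : (E : Adjacency)
  → {True (all? λ a → all? λ b → E a b Bool.≟ E b a)}
  → {True (all? λ a → E a a Bool.≟ false)}
  → {True (all? λ a → degree E a ℕ.≟ 3)}
  → Graph6
cubicByEvaluation E {symmetric} {loopless} {cubic} = record
  { adj    = E
  ; sym    = byEvaluation₂ (λ a b → E a b Bool.≟ E b a) {symmetric}
  ; irrefl = byEvaluation (λ a → E a a Bool.≟ false) {loopless}
  ; deg3   = byEvaluation (λ a → degree E a ℕ.≟ 3) {cubic}
  }

prismGraph k33Graph : Graph6
prismGraph = cubicByEvaluation Prism
k33Graph   = cubicByEvaluation K33

prism-break-K33 : Break prismGraph k33Graph
prism-break-K33 = 1F , 3F , 5F , 2F , 0F , refl , refl , refl , refl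
  , (λ ()) , (λ ()) , (λ ()) , (λ ()) , (λ ()) , (λ ()) , refl , refl
  , byEvaluation₂ (λ a b → K33 a b Bool.≟ swapEdges Prism 3F 5F 2F 0F 3F 2F 5F 0F a b)

lemma10 : (G : Graph6) → InB G → Σ Graph6 λ G' → InA G' × Adjacent G G'
lemma10 G (σ , G≅prism) =
  relabel k33Graph , relabel-iso k33Graph ,
  inj₁ (inj₂ (break-relabel G prismGraph k33Graph G≅prism prism-break-K33))
  where open Relabelling σ
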